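{- Let $D$ be a finite simple digraph (no loops, no parallel arcs; opposite arcs allowed) whose arcs are each colored either blue or red; write $u \overset{b}{\to} v$ (resp. $u \overset{r}{\to} v$) if $(u,v)$ is a blue (resp. red) arc. Suppose that for all vertices $u,v,w$: (i) if $u \overset{b}{\to} v$ and $v \overset{b}{\to} w$, then $u \overset{b}{\to} w$, or ($w \overset{r}{\to} u$ and $w \overset{r}{\to} v$); (ii) if $u \overset{r}{\to} v$ and $v \overset{r}{\to} w$, then $u \overset{r}{\to} w$, or ($v \overset{b}{\to} u$ and $w \overset{b}{\to} u$). If there is a directed path from a vertex $u$ to a vertex $v$ all of whose arcs are blue, then $u \overset{b}{\to} v$ or $v \overset{r}{\to} u$. -}

module Defs where

open import Data.Nat using (ℕ)
open import Data.Fin using (Fin)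
open import Data.Maybe using (Maybe; just; nothing)
open import Relation.Binary.PropositionalEquality using (_≡_)

data Colour : Set where
  blue red : Colour

-- Simplicity: no parallel arcs is automatic (at most one arc per ordered pair);
-- opposite arcs are allowed; loops are excluded by the field noLoop.
record ColouredDigraph (n : ℕ) : Set where
  field
    arc    : Fin n → Fin n → Maybe Colour
    noLoop : ∀ u → arc u u ≡ nothing

open ColouredDigraph public

_⊢_→b_ : ∀ {n} → ColouredDigraph n → Fin n → Fin n → Set
D ⊢ u →b v = arc D u v ≡ just blue

_⊢_→r_ : ∀ {n} → ColouredDigraph n → Fin n → Fin n → Set
D ⊢ u →r v = arc D u v ≡ just red

-- A directed path from u to v all of whose arcs are blue (length ≥ 0;
-- repeated vertices allowed, i.e. a walk; existence of a blue walk is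
-- equivalent to existence of a blue path).
data BluePath {n} (D : ColouredDigraph n) : Fin n → Fin n → Set where
  here : ∀ {u} → BluePath D u u
  step : ∀ {u v w} → D ⊢ u →b v → BluePath D v w → BluePath D u w

-- Induct on a blue walk u → x → y ⇝ v.  Condition (i) on u → x → y either
-- shortcuts the walk to u → y ⇝ v, or yields y →r u.  In the latter case the
-- (inductively known) relation between y and v is pushed back to u: a red arc
-- v →r y composes with y →r u by (ii), and a blue arc y →b v is handled by (i)
-- on x → y → v followed by (i) or (ii) once more.
module Submission where

open import Defs
open import Data.Fin using (Fin)
open import Data.Product using (_×_; _,_)
open import Data.Sum using (_⊎_; inj₁; inj₂; [_,_])
open import Relation.Nullary using (¬_)
open import Relation.Binary.PropositionalEquality using (_≡_; refl)

_⊢_⇝_ : ∀ {n} → ColouredDigraph n → Fin n → Fin n → Set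
D ⊢ u ⇝ v = (D ⊢ u →b v) ⊎ (D ⊢ v →r u)

module _ {n} (D : ColouredDigraph n)
    (blue-condition : ∀ u v w → D ⊢ u →b v → D ⊢ v →b w → (D ⊢ u →b w) ⊎ ((D ⊢ w →r u) × (D ⊢ w →r v)))
    (red-condition : ∀ u v w → D ⊢ u →r v → D ⊢ v →r w → (D ⊢ u →r w) ⊎ ((D ⊢ v →b u) × (D ⊢ w →b u))) where

  blue-blue⇒⇝ : ∀ {u x v} → D ⊢ u →b x → D ⊢ x →b v → D ⊢ u ⇝ v
  blue-blue⇒⇝ ux xv with blue-condition _ _ _ ux xv
  ... | inj₁ uv       = inj₁ uv
  ... | inj₂ (vu , _) = inj₂ vu

  red-red⇒⇝ : ∀ {u x v} → D ⊢ v →r x → D ⊢ x →r u → D ⊢ u ⇝ v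
  red-red⇒⇝ vx xu with red-condition _ _ _ vx xu
  ... | inj₁ vu       = inj₂ vu
  ... | inj₂ (_ , uv) = inj₁ uv

  ⇝-pullback : ∀ {u x y v} → D ⊢ u →b x → D ⊢ x →b y → D ⊢ y →r u → D ⊢ y ⇝ v → D ⊢ u ⇝ v
  ⇝-pullback _  _  yu (inj₂ vy) = red-red⇒⇝ vy yu
  ⇝-pullback ux xy yu (inj₁ yv) with blue-condition _ _ _ xy yv
  ... | inj₁ xv       = blue-blue⇒⇝ ux xv
  ... | inj₂ (_ , vy) = red-red⇒⇝ vy yu

  blueWalk⇒⇝ : ∀ {u x v} → D ⊢ u →b x → BluePath D x v → D ⊢ u ⇝ v
  blueWalk⇒⇝ ux here                      = inj₁ ux
  blueWalk⇒⇝ ux (step xy here)            = blue-blue⇒⇝ ux xy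
  -- [_,_] rather than `with`: the termination checker does not see through the with-function here.
  blueWalk⇒⇝ ux (step xy (step yz rest)) =
    [ (λ uy → blueWalk⇒⇝ uy (step yz rest))
    , (λ (yu , _) → ⇝-pullback ux xy yu (blueWalk⇒⇝ yz rest))
    ] (blue-condition _ _ _ ux xy)

lemma2p4 : ∀ {n} (D : ColouredDigraph n)
    → (∀ u v w → D ⊢ u →b v → D ⊢ v →b w → (D ⊢ u →b w) ⊎ ((D ⊢ w →r u) × (D ⊢ w →r v)))
    → (∀ u v w → D ⊢ u →r v → D ⊢ v →r w → (D ⊢ u →r w) ⊎ ((D ⊢ v →b u) × (D ⊢ w →b u)))
    → ∀ u v → ¬ (u ≡ v) → BluePath D u v → (D ⊢ u →b v) ⊎ (D ⊢ v →r u)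
lemma2p4 D bc rc u .u u≢u here          with () ← u≢u refl
lemma2p4 D bc rc u v  _   (step ux rest) = blueWalk⇒⇝ D bc rc ux rest
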